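{- Let $\mathcal{G}$ be the Sprague–Grundy function of Exco-Nim with $n=2$. If a position $x=(x_0,x_1,x_2)$ satisfies $x_0\ge 2^{k-1}$ and $x_1<2^k$ for some nonnegative integer $k$, then $\mathcal{G}(x)=x_0+x_1+x_2$.
   Context: Exco-Nim with $n=2$: positions are triples $x=(x_0,x_1,x_2)$ of nonnegative integers. A legal move $x\to x'$ is to a triple $x'$ of nonnegative integers with $x'_j\le x_j$ for $j=0,1,2$, $x'_0+x'_1+x'_2<x_0+x_1+x_2$, and $x'_1=x_1$ or $x'_2=x_2$. The Sprague–Grundy function is $\mathcal{G}(x)=\operatorname{mex}\{\mathcal{G}(x'): x\to x'\}$, where $\operatorname{mex}(S)$ is the least nonnegative integer not in $S$. -}

module Defs where

open import Data.Nat using (ℕ; zero; suc; _+_; _<_; _<?_; _≟_; _^_; _≥_; _∸_)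
open import Data.Bool using (Bool; true; false; _∧_; _∨_; if_then_else_)
open import Data.List using (List; []; _∷_; map; concatMap; filter; upTo; length)
open import Data.Bool.ListAction using (any)
open import Data.Product using (_×_; _,_)
open import Relation.Nullary.Decidable using (⌊_⌋)

Pos : Set
Pos = ℕ × ℕ × ℕ

total : Pos → ℕ
total (a , b , c) = a + b + c

-- Boolean test for a legal move x → y (assuming y ≤ x componentwise):
-- total y < total x, and (y₁ = x₁ or y₂ = x₂).
legalᵇ : Pos → Pos → Bool
legalᵇ (a , b , c) (a' , b' , c') =
  ⌊ (a' + b' + c') <? (a + b + c) ⌋ ∧ (⌊ b' ≟ b ⌋ ∨ ⌊ c' ≟ c ⌋)

below : Pos → List Pos
below (a , b , c) =
  concatMap (λ a' → concatMap (λ b' → map (λ c' → (a' , b' , c'))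
    (upTo (suc c))) (upTo (suc b))) (upTo (suc a))

options : Pos → List Pos
options x = filter (λ y → legalᵇ x y ≟ᵇ true) (below x)
  where
  open import Data.Bool using () renaming (_≟_ to _≟ᵇ_)

elemᵇ : ℕ → List ℕ → Bool
elemᵇ m xs = any (λ k → ⌊ m ≟ k ⌋) xs

mexFrom : ℕ → ℕ → List ℕ → ℕ
mexFrom zero m xs = m
mexFrom (suc f) m xs = if elemᵇ m xs then mexFrom f (suc m) xs else m

mex : List ℕ → ℕ
mex xs = mexFrom (suc (length xs)) 0 xs

-- Sprague–Grundy function with fuel; fuel ≥ total x makes it exact,
-- since every move strictly decreases the total.
SGfuel : ℕ → Pos → ℕ
SGfuel zero x = 0
SGfuel (suc f) x = mex (map (SGfuel f) (options x))

𝒢 : Pos → ℕ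
𝒢 x = SGfuel (total x) x

module Submission where

-- Since 𝒢 never exceeds the total, it suffices to reach every smaller value
-- by a move.  Positions (0, b, c) form two-heap Nim; by induction on
-- j, the Nim values on the square [0, 2^j)² lie below 2^j and every column
-- and row takes each such value (`nim-square`).  The step uses two top-bit lemmas:
-- adding 2^j to both Nim heaps of any position does not change 𝒢 below 2^j
-- (`top-bit-agree`), and adding 2^j to one heap of a Nim position adds 2^j to
-- its value (`top-bit-shift`).  Finally the theorem is proved by induction on
-- the total: writing x₁ = 2^j + β by its leading binary digit, each smaller
-- value is reached by an explicit move (`MainCase`).

open import Defs
open import Data.Nat using (ℕ; zero; suc; _+_; _^_; _≤_; _<_; _∸_; z≤n; s≤s; s≤s⁻¹; _<?_; _≟_)
open import Data.Nat.Properties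
open import Data.Nat.Induction using (<-wellFounded)
open import Data.Nat.Tactic.RingSolver using (solve-∀)
open import Data.Bool using (true; false; T; _∨_) renaming (_≟_ to _≟ᵇ_)
open import Data.Bool.Properties using (T-≡; T-∧; T-∨)
open import Data.Product using (∃-syntax; _×_; _,_; proj₁; proj₂)
open import Data.Sum using (_⊎_; inj₁; inj₂)
import Data.Sum as Sum
open import Data.Unit using (tt)
open import Data.Empty using (⊥-elim)
open import Data.List using (List; map; filter; length; concatMap; upTo)
open import Data.List.Properties using (filter-notAll; map-cong-local)
open import Data.List.Membership.Propositional using (_∈_; _∉_; find; lose)
open import Data.List.Membership.Propositional.Properties
  using (∈-map⁺; ∈-map⁻; ∈-concatMap⁺; ∈-concatMap⁻; ∈-upTo⁺; ∈-upTo⁻; ∈-filter⁺; ∈-filter⁻)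
import Data.List.Relation.Unary.Any as Any
open import Data.List.Relation.Unary.Any.Properties using (any⁺; any⁻)
import Data.List.Relation.Unary.All as All
open import Function.Bundles using (Equivalence)
open import Induction.WellFounded as WF using ()
import Relation.Binary.Construct.On as On
open import Relation.Nullary using (Dec; ¬?)
open import Relation.Nullary.Decidable using (yes; no; ⌊_⌋; toWitness; fromWitness)
open import Relation.Binary.PropositionalEquality

open Equivalence using (to; from)

measure-induction : {A : Set} (μ : A → ℕ) (P : A → Set) →
  (∀ x → (∀ y → μ y < μ x → P y) → P x) → ∀ x → P x
measure-induction μ P step =
  WF.All.wfRec (On.wellFounded μ <-wellFounded) _ P (λ x ih → step x (λ y → ih))

data Split (h : ℕ) : ℕ → Set where
  under : ∀ {n} → n < h → Split h n
  over  : ∀ m → Split h (h + m)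

split : ∀ h n → Split h n
split h n with n <? h
... | yes n<h = under n<h
... | no  n≮h = subst (Split h) (m+[n∸m]≡n (≮⇒≥ n≮h)) (over (n ∸ h))

record Legal (a b c a' b' c' : ℕ) : Set where
  constructor legal
  field
    shrink₀   : a' ≤ a
    shrink₁   : b' ≤ b
    shrink₂   : c' ≤ c
    decreases : a' + b' + c' < a + b + c
    keeps     : b' ≡ b ⊎ c' ≡ c

Move : Pos → Pos → Set
Move (a , b , c) (a' , b' , c') = Legal a b c a' b' c'

move-decreases : ∀ x y → Move x y → total y < total x
move-decreases (_ , _ , _) (_ , _ , _) = Legal.decreases

∈-below⁺ : ∀ {a b c a' b' c'} → a' ≤ a → b' ≤ b → c' ≤ c →
  (a' , b' , c') ∈ below (a , b , c)
∈-below⁺ {a} {b} {c} {a'} {b'} a'≤a b'≤b c'≤c =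
  ∈-concatMap⁺ (λ p → concatMap (λ q → map (λ r → (p , q , r)) (upTo (suc c))) (upTo (suc b)))
    (lose (∈-upTo⁺ (s≤s a'≤a))
      (∈-concatMap⁺ (λ q → map (λ r → (a' , q , r)) (upTo (suc c)))
        (lose (∈-upTo⁺ (s≤s b'≤b)) (∈-map⁺ (λ r → (a' , b' , r)) (∈-upTo⁺ (s≤s c'≤c))))))

∈-below⁻ : ∀ {a b c a' b' c'} → (a' , b' , c') ∈ below (a , b , c) →
  a' ≤ a × b' ≤ b × c' ≤ c
∈-below⁻ {a} {b} {c} y∈
  with p , p∈ , y∈₁ ← find (∈-concatMap⁻ (λ p → concatMap (λ q → map (λ r → (p , q , r))
                              (upTo (suc c))) (upTo (suc b))) {xs = upTo (suc a)} y∈)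
  with q , q∈ , y∈₂ ← find (∈-concatMap⁻ (λ q → map (λ r → (p , q , r)) (upTo (suc c)))
                              {xs = upTo (suc b)} y∈₁)
  with r , r∈ , refl ← ∈-map⁻ (λ r → (p , q , r)) {xs = upTo (suc c)} y∈₂
  = s≤s⁻¹ (∈-upTo⁻ p∈) , s≤s⁻¹ (∈-upTo⁻ q∈) , s≤s⁻¹ (∈-upTo⁻ r∈)

legalᵇ⁺ : ∀ {a b c a' b' c'} → Legal a b c a' b' c' → T (legalᵇ (a , b , c) (a' , b' , c'))
legalᵇ⁺ {a} {b} {c} {a'} {b'} {c'} (legal _ _ _ dec keep) =
  from (T-∧ {⌊ a' + b' + c' <? a + b + c ⌋} {⌊ b' ≟ b ⌋ ∨ ⌊ c' ≟ c ⌋})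
    (fromWitness dec , from (T-∨ {⌊ b' ≟ b ⌋}) (Sum.map fromWitness fromWitness keep))

legalᵇ⁻ : ∀ {a b c a' b' c'} → T (legalᵇ (a , b , c) (a' , b' , c')) →
  a' + b' + c' < a + b + c × (b' ≡ b ⊎ c' ≡ c)
legalᵇ⁻ {a} {b} {c} {a'} {b'} {c'} ok
  with dec , keep ← to (T-∧ {⌊ a' + b' + c' <? a + b + c ⌋} {⌊ b' ≟ b ⌋ ∨ ⌊ c' ≟ c ⌋}) ok
  = toWitness dec , Sum.map toWitness toWitness (to (T-∨ {⌊ b' ≟ b ⌋}) keep)

move⇒option : ∀ x y → Move x y → y ∈ options x
move⇒option (a , b , c) (a' , b' , c') mv@(legal s₀ s₁ s₂ _ _) =
  ∈-filter⁺ (λ y → legalᵇ (a , b , c) y ≟ᵇ true) (∈-below⁺ s₀ s₁ s₂)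
    (to T-≡ (legalᵇ⁺ mv))

option⇒move : ∀ x y → y ∈ options x → Move x y
option⇒move (a , b , c) (a' , b' , c') y∈
  with y∈below , ok ← ∈-filter⁻ (λ y → legalᵇ (a , b , c) y ≟ᵇ true)
                         {xs = below (a , b , c)} y∈
  with s₀ , s₁ , s₂ ← ∈-below⁻ y∈below
  with dec , keep ← legalᵇ⁻ {a} {b} {c} (from T-≡ ok)
  = legal s₀ s₁ s₂ dec keep

IsMex : List ℕ → ℕ → Set
IsMex xs m = (∀ {v} → v < m → v ∈ xs) × m ∉ xs

elemᵇ-sound : ∀ m xs → T (elemᵇ m xs) → m ∈ xs
elemᵇ-sound m xs found = Any.map toWitness (any⁻ _ xs found)

elemᵇ-complete : ∀ {m xs} → m ∈ xs → T (elemᵇ m xs)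
elemᵇ-complete m∈xs = any⁺ _ (Any.map fromWitness m∈xs)

-- Pigeonhole: a list containing each of 0, …, n - 1 has length at least n.
-- It bounds the number of steps the mex search can take.
covering⇒long : ∀ n xs → (∀ {v} → v < n → v ∈ xs) → n ≤ length xs
covering⇒long zero    xs covers = z≤n
covering⇒long (suc n) xs covers =
  ≤-trans (s≤s (covering⇒long n (filter ≢n? xs) covers′)) shorter
  where
  ≢n? : ∀ k → Dec (k ≢ n)
  ≢n? k = ¬? (k ≟ n)
  covers′ : ∀ {v} → v < n → v ∈ filter ≢n? xs
  covers′ v<n = ∈-filter⁺ ≢n? (covers (m<n⇒m<1+n v<n)) (λ v≡n → <-irrefl v≡n v<n)
  shorter : length (filter ≢n? xs) < length xs
  shorter = filter-notAll ≢n? xs (lose (covers ≤-refl) (λ ¬n≢n → ¬n≢n refl))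

mexFrom-correct : ∀ f m xs → (∀ {v} → v < m → v ∈ xs) → length xs < f + m →
  IsMex xs (mexFrom f m xs)
mexFrom-correct zero    m xs covers enough = ⊥-elim (<⇒≱ enough (covering⇒long m xs covers))
mexFrom-correct (suc f) m xs covers enough with elemᵇ m xs in found
... | true  = mexFrom-correct f (suc m) xs covers′ (subst (length xs <_) (sym (+-suc f m)) enough)
  where
  covers′ : ∀ {v} → v < suc m → v ∈ xs
  covers′ v<1+m with m<1+n⇒m<n∨m≡n v<1+m
  ... | inj₁ v<m  = covers v<m
  ... | inj₂ refl = elemᵇ-sound m xs (subst T (sym found) tt)
... | false = covers , λ m∈xs → subst T found (elemᵇ-complete m∈xs)

mex-correct : ∀ xs → IsMex xs (mex xs)
mex-correct xs = mexFrom-correct (suc (length xs)) 0 xs (λ ()) (s≤s (m≤m+n (length xs) 0))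

option-decreases : ∀ {x y} → y ∈ options x → total y < total x
option-decreases {x} {y} y∈ = move-decreases x y (option⇒move x y y∈)

fuel-stable : ∀ f x → total x ≤ f → SGfuel (suc f) x ≡ SGfuel f x
fuel-stable zero    (zero , zero , zero) _ = refl
fuel-stable (suc f) x enough = cong mex (map-cong-local {xs = options x} (All.tabulate λ {y} y∈ →
  fuel-stable f y (s≤s⁻¹ (<-≤-trans (option-decreases {x} y∈) enough))))

fuel-enough : ∀ {f} x → total x ≤ f → SGfuel f x ≡ 𝒢 x
fuel-enough {f} x enough =
  subst (λ n → SGfuel n x ≡ 𝒢 x) (m∸n+n≡m enough) (extra (f ∸ total x))
  where
  extra : ∀ d → SGfuel (d + total x) x ≡ 𝒢 x
  extra zero    = refl
  extra (suc d) = trans (fuel-stable (d + total x) x (m≤n+m (total x) d)) (extra d)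

𝒢-mex : ∀ x → 𝒢 x ≡ mex (map 𝒢 (options x))
𝒢-mex x = trans (sym (fuel-stable (total x) x ≤-refl))
  (cong mex (map-cong-local {xs = options x} (All.tabulate λ {y} y∈ →
    fuel-enough y (<⇒≤ (option-decreases {x} y∈)))))

Reaches : Pos → ℕ → Set
Reaches x v = ∃[ y ] Move x y × 𝒢 y ≡ v

reaches-below : ∀ x {v} → v < 𝒢 x → Reaches x v
reaches-below x {v} v<𝒢x
  with y , y∈ , refl ← ∈-map⁻ 𝒢 (proj₁ (mex-correct (map 𝒢 (options x)))
                                        (subst (v <_) (𝒢-mex x) v<𝒢x))
  = y , option⇒move x y y∈ , refl

𝒢-avoids : ∀ x {y} → Move x y → 𝒢 y ≢ 𝒢 x
𝒢-avoids x {y} mv 𝒢y≡𝒢x = proj₂ (mex-correct (map 𝒢 (options x)))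
  (subst (_∈ map 𝒢 (options x)) (trans 𝒢y≡𝒢x (𝒢-mex x)) (∈-map⁺ 𝒢 (move⇒option x y mv)))

𝒢-≥ : ∀ x {m} → (∀ {v} → v < m → Reaches x v) → m ≤ 𝒢 x
𝒢-≥ x reach = ≮⇒≥ λ 𝒢x<m →
  let y , mv , 𝒢y≡𝒢x = reach 𝒢x<m in 𝒢-avoids x mv 𝒢y≡𝒢x

𝒢-≡ : ∀ x {m} → (∀ {v} → v < m → Reaches x v) → (∀ {y} → Move x y → 𝒢 y ≢ m) →
  𝒢 x ≡ m
𝒢-≡ x reach avoid = ≤-antisym
  (≮⇒≥ λ m<𝒢x → let y , mv , 𝒢y≡m = reaches-below x m<𝒢x in avoid mv 𝒢y≡m)
  (𝒢-≥ x reach)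

total-induction : (P : Pos → Set) →
  (∀ x → (∀ y → total y < total x → P y) → P x) → ∀ x → P x
total-induction = measure-induction total

-- 𝒢 never exceeds the total: a value equal to the total would have to be
-- reached from a position with a smaller total.
𝒢-≤-total : ∀ x → 𝒢 x ≤ total x
𝒢-≤-total = total-induction (λ x → 𝒢 x ≤ total x) λ x ih → ≮⇒≥ λ total<𝒢 →
  let y , mv , 𝒢y≡total = reaches-below x total<𝒢
      y<x : total y < total x
      y<x = move-decreases x y mv
  in <-irrefl 𝒢y≡total (≤-<-trans (ih y y<x) y<x)

𝒢-≡-total : ∀ x → (∀ {v} → v < total x → Reaches x v) → 𝒢 x ≡ total x
𝒢-≡-total x reach = ≤-antisym (𝒢-≤-total x) (𝒢-≥ x reach)

swap : Pos → Pos
swap (a , b , c) = (a , c , b)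

swap-move : ∀ x y → Move x y → Move (swap x) (swap y)
swap-move (a , b , c) (a' , b' , c') (legal s₀ s₁ s₂ dec keep) =
  legal s₀ s₂ s₁ (subst₂ _<_ (exchange a' b' c') (exchange a b c) dec) (Sum.swap keep)
  where
  exchange : ∀ p q r → p + q + r ≡ p + r + q
  exchange = solve-∀

𝒢-swap : ∀ x → 𝒢 (swap x) ≡ 𝒢 x
𝒢-swap = total-induction (λ x → 𝒢 (swap x) ≡ 𝒢 x) λ where
  x@(a , b , c) ih → 𝒢-≡ (swap x)
    (λ v<𝒢x → let y , mv , 𝒢y≡v = reaches-below x v<𝒢x
              in swap y , swap-move x y mv , trans (ih y (move-decreases x y mv)) 𝒢y≡v)
    (λ {y@(_ , _ , _)} mv 𝒢y≡𝒢x →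
      let mv′ : Move x (swap y)
          mv′ = swap-move (swap x) y mv
      in 𝒢-avoids x mv′ (trans (sym (ih (swap y) (move-decreases x (swap y) mv′))) 𝒢y≡𝒢x))

keep₁-move : ∀ {a b c a' c'} → a' ≤ a → c' ≤ c → a' + c' < a + c → Move (a , b , c) (a' , b , c')
keep₁-move {a} {b} {c} {a'} {c'} s₀ s₂ lt =
  legal s₀ ≤-refl s₂ (subst₂ _<_ (middle a' b c') (middle a b c) (+-monoʳ-< b lt)) (inj₁ refl)
  where
  middle : ∀ p q r → q + (p + r) ≡ p + q + r
  middle = solve-∀

keep₂-move : ∀ {a b c a' b'} → a' ≤ a → b' ≤ b → a' + b' < a + b → Move (a , b , c) (a' , b' , c)
keep₂-move {c = c} s₀ s₁ lt = legal s₀ s₁ ≤-refl (+-monoˡ-< c lt) (inj₂ refl)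

-- With heap 1 empty, 𝒢 is the total: any smaller value v is reached by
-- moving to (v, 0, 0) when v < a and to (a, 0, v - a) otherwise.
𝒢-empty₁ : ∀ a c → 𝒢 (a , 0 , c) ≡ a + c
𝒢-empty₁ a c = total-induction P step (a , 0 , c) refl
  where
  P : Pos → Set
  P (a , b , c) = b ≡ 0 → 𝒢 (a , b , c) ≡ a + c
  step : ∀ x → (∀ y → total y < total x → P y) → P x
  step x@(a , _ , c) ih refl = trans (𝒢-≡-total x reach) a+0+c≡a+c
    where
    a+0+c≡a+c : a + 0 + c ≡ a + c
    a+0+c≡a+c = cong (_+ c) (+-identityʳ a)
    reach : ∀ {v} → v < total x → Reaches x v
    reach {v} v<t with split a v
    ... | under v<a = y , mv , trans (ih y (move-decreases x y mv) refl) (+-identityʳ v)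
      where
      y : Pos
      y = (v , 0 , 0)
      mv : Move x y
      mv = keep₁-move (<⇒≤ v<a) z≤n (+-mono-<-≤ v<a z≤n)
    ... | over r = y , mv , ih y (move-decreases x y mv) refl
      where
      y : Pos
      y = (a , 0 , r)
      r<c : r < c
      r<c = +-cancelˡ-< a r c (subst (a + r <_) a+0+c≡a+c v<t)
      mv : Move x y
      mv = keep₁-move ≤-refl (<⇒≤ r<c) (+-monoʳ-< a r<c)

𝒢-empty₂ : ∀ a b → 𝒢 (a , b , 0) ≡ a + b
𝒢-empty₂ a b = trans (𝒢-swap (a , 0 , b)) (𝒢-empty₁ a b)

translate : ℕ → ℕ → Pos → Pos
translate p q (a , b , c) = (a , p + b , q + c)

total-translate : ∀ p q x → total (translate p q x) ≡ total x + (p + q)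
total-translate p q (a , b , c) = shuffle a b c p q
  where
  shuffle : ∀ a b c p q → a + (p + b) + (q + c) ≡ a + b + c + (p + q)
  shuffle = solve-∀

translate-move : ∀ p q x y → Move x y → Move (translate p q x) (translate p q y)
translate-move p q (a , b , c) (a' , b' , c') (legal s₀ s₁ s₂ dec keep) =
  legal s₀ (+-monoʳ-≤ p s₁) (+-monoʳ-≤ q s₂)
    (subst₂ _<_ (sym (total-translate p q (a' , b' , c'))) (sym (total-translate p q (a , b , c)))
      (+-monoˡ-< (p + q) dec))
    (Sum.map (cong (p +_)) (cong (q +_)) keep)

untranslate-move : ∀ p q x y → Move (translate p q x) (translate p q y) → Move x y
untranslate-move p q (a , b , c) (a' , b' , c') (legal s₀ s₁ s₂ dec keep) =
  legal s₀ (+-cancelˡ-≤ p b' b s₁) (+-cancelˡ-≤ q c' c s₂)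
    (+-cancelʳ-< (p + q) (a' + b' + c') (a + b + c)
      (subst₂ _<_ (total-translate p q (a' , b' , c')) (total-translate p q (a , b , c)) dec))
    (Sum.map (+-cancelˡ-≡ p b' b) (+-cancelˡ-≡ q c' c) keep)

-- With heap 0 empty no move can refill it, so positions (0, b, c) form
-- two-heap Nim.  Level-j properties of its square [0, 2^j)²:
-- every column takes every value below 2^j ...
Solvable : ℕ → Set
Solvable j = ∀ {c v} → c < 2 ^ j → v < 2 ^ j → ∃[ b ] b < 2 ^ j × 𝒢 (0 , b , c) ≡ v

Bounded : ℕ → Set
Bounded j = ∀ {b c} → b < 2 ^ j → c < 2 ^ j → 𝒢 (0 , b , c) < 2 ^ j

solvable-row : ∀ j → Solvable j → ∀ {b v} → b < 2 ^ j → v < 2 ^ j →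
  ∃[ c ] c < 2 ^ j × 𝒢 (0 , b , c) ≡ v
solvable-row j solvable {b} b< v< =
  let c , c< , 𝒢≡v = solvable b< v< in c , c< , trans (𝒢-swap (0 , c , b)) 𝒢≡v

to-plane₁ : ∀ {a b c b'} → b' < b → Move (a , b , c) (0 , b' , c)
to-plane₁ b'<b = keep₂-move z≤n (<⇒≤ b'<b) (+-mono-≤-< z≤n b'<b)

to-plane₂ : ∀ {a b c c'} → c' < c → Move (a , b , c) (0 , b , c')
to-plane₂ c'<c = keep₁-move z≤n (<⇒≤ c'<c) (+-mono-≤-< z≤n c'<c)

-- If heap 1 lies below 2^j and heap 2 does not, every value below 2^j is
-- reached inside the Nim plane, so 𝒢 ≥ 2^j.
straddle-≥ : ∀ j → Solvable j → ∀ a {b c} → b < 2 ^ j → 2 ^ j ≤ c → 2 ^ j ≤ 𝒢 (a , b , c)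
straddle-≥ j solvable a {b} {c} b< c≥ = 𝒢-≥ (a , b , c) λ v< →
  let c' , c'< , 𝒢≡v = solvable-row j solvable b< v<
  in (0 , b , c') , to-plane₂ (<-≤-trans c'< c≥) , 𝒢≡v

AgreeBelow : ℕ → ℕ → ℕ → Set
AgreeBelow h m n = (m < h → n ≡ m) × (h ≤ m → h ≤ n)

Low : ℕ → Pos → Set
Low h (_ , b , c) = b < h × c < h

move-low : ∀ {h} x y → Move x y → Low h x → Low h y
move-low (_ , _ , _) (_ , _ , _) (legal _ s₁ s₂ _ _) (b< , c<) = ≤-<-trans s₁ b< , ≤-<-trans s₂ c<

agree-avoids : ∀ {h m n k} → AgreeBelow h m n → k < h → m ≢ k → n ≢ k
agree-avoids {h} {m} (same , large) k<h m≢k with m <? h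
... | yes m<h = λ n≡k → m≢k (trans (sym (same m<h)) n≡k)
... | no  m≮h = λ n≡k → <⇒≱ k<h (subst (h ≤_) n≡k (large (≮⇒≥ m≮h)))

shift-reaches : ∀ h x {v} → v < h →
  (∀ {y} → Move x y → AgreeBelow h (𝒢 y) (𝒢 (translate h h y))) →
  Reaches x v → Reaches (translate h h x) v
shift-reaches h x v<h agree (y , mv , refl) =
  translate h h y , translate-move h h x y mv , proj₁ (agree mv) v<h

-- In a move from (a, h + β, h + γ) that drops one Nim heap below h, the
-- other heap must be the kept one, so it stays at least h.
kept-other : ∀ {h β γ b' c'} → b' < h → b' ≡ h + β ⊎ c' ≡ h + γ → h ≤ c'
kept-other {h} {β} b'<h (inj₁ refl) = ⊥-elim (<⇒≱ b'<h (m≤m+n h β))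
kept-other {h} {γ = γ} _ (inj₂ refl) = m≤m+n h γ

-- An option of the shifted position either drops a heap below 2^j, and then
-- has value ≥ 2^j by `straddle-≥`, or is the shift of an option of x.
top-bit-agree : ∀ j → Solvable j → ∀ x → Low (2 ^ j) x →
  AgreeBelow (2 ^ j) (𝒢 x) (𝒢 (translate (2 ^ j) (2 ^ j) x))
top-bit-agree j solvable = total-induction P step
  where
  h : ℕ
  h = 2 ^ j
  P : Pos → Set
  P x = Low h x → AgreeBelow h (𝒢 x) (𝒢 (translate h h x))
  step : ∀ x → (∀ y → total y < total x → P y) → P x
  step x@(_ , _ , _) ih low = agree-small , agree-large
    where
    z : Pos
    z = translate h h x
    agree-options : ∀ {y} → Move x y → AgreeBelow h (𝒢 y) (𝒢 (translate h h y))
    agree-options {y} mv = ih y (move-decreases x y mv) (move-low x y mv low)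
    reach : ∀ {v} → v < 𝒢 x → v < h → Reaches z v
    reach v<𝒢x v<h = shift-reaches h x v<h agree-options (reaches-below x v<𝒢x)
    agree-large : h ≤ 𝒢 x → h ≤ 𝒢 z
    agree-large h≤𝒢x = 𝒢-≥ z λ v<h → reach (<-≤-trans v<h h≤𝒢x) v<h
    agree-small : 𝒢 x < h → 𝒢 z ≡ 𝒢 x
    agree-small 𝒢x<h = 𝒢-≡ z (λ v<𝒢x → reach v<𝒢x (<-trans v<𝒢x 𝒢x<h)) avoid
      where
      large : ∀ {n} → h ≤ n → n ≢ 𝒢 x
      large h≤n refl = <⇒≱ 𝒢x<h h≤n
      avoid : ∀ {y} → Move z y → 𝒢 y ≢ 𝒢 x
      avoid {a' , b' , c'} mv@(legal _ _ _ _ keep) with split h b' | split h c'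
      ... | under b'<h | _ = large (straddle-≥ j solvable a' b'<h (kept-other b'<h keep))
      ... | over _ | under c'<h = large (subst (h ≤_) (sym (𝒢-swap (a' , c' , b')))
                                          (straddle-≥ j solvable a' c'<h (kept-other c'<h (Sum.swap keep))))
      ... | over β' | over γ' = agree-avoids (agree-options mv′) 𝒢x<h (𝒢-avoids x mv′)
        where
        mv′ : Move x (a' , β' , γ')
        mv′ = untranslate-move h h x (a' , β' , γ') mv

top-bit-cancel : ∀ j → Solvable j → ∀ {a β γ} → β < 2 ^ j → γ < 2 ^ j → 𝒢 (a , β , γ) < 2 ^ j →
  𝒢 (a , 2 ^ j + β , 2 ^ j + γ) ≡ 𝒢 (a , β , γ)
top-bit-cancel j solvable {a} {β} {γ} β< γ< = proj₁ (top-bit-agree j solvable (a , β , γ) (β< , γ<))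

-- Values below 2^j are reached by playing in the enlarged heap
-- down to the square (`Solvable`); values 2^j + μ by shifting an option of
-- (0, β, c); and an option of value 2^j + 𝒢(0, β, c) would either lie in the
-- square (contradicting `Bounded`) or be the shift of an option of (0, β, c).
top-bit-shift : ∀ j → Solvable j → Bounded j → ∀ {β c} → β < 2 ^ j → c < 2 ^ j →
  𝒢 (0 , 2 ^ j + β , c) ≡ 2 ^ j + 𝒢 (0 , β , c)
top-bit-shift j solvable bounded {β} {c} = measure-induction (λ (β , c) → β + c) P step (β , c)
  where
  h : ℕ
  h = 2 ^ j
  P : ℕ × ℕ → Set
  P (β , c) = β < h → c < h → 𝒢 (0 , h + β , c) ≡ h + 𝒢 (0 , β , c)
  step : ∀ p → (∀ q → proj₁ q + proj₂ q < proj₁ p + proj₂ p → P q) → P p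
  step (β , c) ih β<h c<h = 𝒢-≡ z reach avoid
    where
    x z : Pos
    x = (0 , β , c)
    z = translate h 0 x
    -- Moves from the Nim plane stay in it: `z≤n` forces heap 0 to be empty.
    shift-option : ∀ {y} → Move x y → Reaches z (h + 𝒢 y)
    shift-option {_ , β' , c'} mv@(legal z≤n s₁ s₂ dec _) =
      (0 , h + β' , c') , translate-move h 0 x (0 , β' , c') mv ,
      ih (β' , c') dec (≤-<-trans s₁ β<h) (≤-<-trans s₂ c<h)
    reach : ∀ {v} → v < h + 𝒢 x → Reaches z v
    reach {v} v< with split h v
    ... | under v<h = let b' , b'<h , 𝒢≡v = solvable c<h v<h
                      in (0 , b' , c) , to-plane₁ (<-≤-trans b'<h (m≤m+n h β)) , 𝒢≡v
    ... | over μ with y , mv , refl ← reaches-below x (+-cancelˡ-< h μ (𝒢 x) v<) = shift-option mv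
    avoid : ∀ {y} → Move z y → 𝒢 y ≢ h + 𝒢 x
    avoid {_ , b' , c'} mv@(legal z≤n _ s₂ _ _) 𝒢≡ with split h b'
    ... | under b'<h =
      <⇒≱ (bounded b'<h (≤-<-trans s₂ c<h)) (subst (h ≤_) (sym 𝒢≡) (m≤m+n h (𝒢 x)))
    ... | over β' = 𝒢-avoids x mv′
      (+-cancelˡ-≡ h _ _ (trans (sym (ih (β' , c') (Legal.decreases mv′) β'<h c'<h)) 𝒢≡))
      where
      mv′ : Move x (0 , β' , c')
      mv′ = untranslate-move h 0 x (0 , β' , c') mv
      β'<h : β' < h
      β'<h = ≤-<-trans (Legal.shrink₁ mv′) β<h
      c'<h : c' < h
      c'<h = ≤-<-trans s₂ c<h

top-bit-shift₂ : ∀ j → Solvable j → Bounded j → ∀ {b γ} → b < 2 ^ j → γ < 2 ^ j →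
  𝒢 (0 , b , 2 ^ j + γ) ≡ 2 ^ j + 𝒢 (0 , b , γ)
top-bit-shift₂ j solvable bounded {b} {γ} b< γ< = begin
  𝒢 (0 , b , 2 ^ j + γ)     ≡⟨ 𝒢-swap (0 , 2 ^ j + γ , b) ⟩
  𝒢 (0 , 2 ^ j + γ , b)     ≡⟨ top-bit-shift j solvable bounded γ< b< ⟩
  2 ^ j + 𝒢 (0 , γ , b)     ≡⟨ cong (2 ^ j +_) (𝒢-swap (0 , b , γ)) ⟩
  2 ^ j + 𝒢 (0 , b , γ)     ∎
  where open ≡-Reasoning

data Halves (j : ℕ) : ℕ → Set where
  lower : ∀ {n} → n < 2 ^ j → Halves j n
  upper : ∀ {m} → m < 2 ^ j → Halves j (2 ^ j + m)

double : ∀ j → 2 ^ suc j ≡ 2 ^ j + 2 ^ j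
double j = cong (2 ^ j +_) (+-identityʳ (2 ^ j))

halves : ∀ j {n} → n < 2 ^ suc j → Halves j n
halves j {n} n< with split (2 ^ j) n
... | under n<h = lower n<h
... | over m    = upper (+-cancelˡ-< (2 ^ j) m (2 ^ j) (subst (2 ^ j + m <_) (double j) n<))

lower-bound : ∀ j {n} → n < 2 ^ j → n < 2 ^ suc j
lower-bound j n< = <-≤-trans n< (m≤m+n (2 ^ j) _)

upper-bound : ∀ j {m} → m < 2 ^ j → 2 ^ j + m < 2 ^ suc j
upper-bound j {m} m< = subst (2 ^ j + m <_) (sym (double j)) (+-monoʳ-< (2 ^ j) m<)

record NimSquare (j : ℕ) : Set where
  field
    solvable : Solvable j
    bounded  : Bounded j

-- Passing from level j to level j + 1: split both coordinates into halves
-- and move between the four quarters with the top-bit lemmas.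
next-square : ∀ j → NimSquare j → NimSquare (suc j)
next-square j square = record { solvable = solvable′ ; bounded = bounded′ }
  where
  open NimSquare square
  h : ℕ
  h = 2 ^ j
  shift₁ : ∀ {β c} → β < h → c < h → 𝒢 (0 , h + β , c) ≡ h + 𝒢 (0 , β , c)
  shift₁ = top-bit-shift j solvable bounded
  shift₂ : ∀ {b γ} → b < h → γ < h → 𝒢 (0 , b , h + γ) ≡ h + 𝒢 (0 , b , γ)
  shift₂ = top-bit-shift₂ j solvable bounded
  cancel : ∀ {β γ} → β < h → γ < h → 𝒢 (0 , β , γ) < h → 𝒢 (0 , h + β , h + γ) ≡ 𝒢 (0 , β , γ)
  cancel = top-bit-cancel j solvable {0}

  solvable′ : Solvable (suc j)
  solvable′ c< v< with halves j c< | halves j v<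
  ... | lower c<h | lower v<h = let b , b<h , 𝒢≡v = solvable c<h v<h
                                in b , lower-bound j b<h , 𝒢≡v
  ... | lower c<h | upper μ<h = let b , b<h , 𝒢≡μ = solvable c<h μ<h
                                in h + b , upper-bound j b<h , trans (shift₁ b<h c<h) (cong (h +_) 𝒢≡μ)
  ... | upper γ<h | lower v<h = let b , b<h , 𝒢≡v = solvable γ<h v<h
                                in h + b , upper-bound j b<h ,
                                   trans (cancel b<h γ<h (subst (_< h) (sym 𝒢≡v) v<h)) 𝒢≡v
  ... | upper γ<h | upper μ<h = let b , b<h , 𝒢≡μ = solvable γ<h μ<h
                                in b , lower-bound j b<h , trans (shift₂ b<h γ<h) (cong (h +_) 𝒢≡μ)

  bounded′ : Bounded (suc j)
  bounded′ b< c< with halves j b< | halves j c<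
  ... | lower b<h | lower c<h = lower-bound j (bounded b<h c<h)
  ... | upper β<h | lower c<h =
    subst (_< 2 ^ suc j) (sym (shift₁ β<h c<h)) (upper-bound j (bounded β<h c<h))
  ... | lower b<h | upper γ<h =
    subst (_< 2 ^ suc j) (sym (shift₂ b<h γ<h)) (upper-bound j (bounded b<h γ<h))
  ... | upper β<h | upper γ<h = let 𝒢<h = bounded β<h γ<h
                                in subst (_< 2 ^ suc j) (sym (cancel β<h γ<h 𝒢<h)) (lower-bound j 𝒢<h)

square₀ : NimSquare 0
square₀ = record { solvable = solvable₀ ; bounded = bounded₀ }
  where
  solvable₀ : Solvable 0
  solvable₀ {zero}  {zero}  _ _ = 0 , s≤s z≤n , refl
  solvable₀ {suc _} (s≤s ()) _
  solvable₀ {zero}  {suc _} _ (s≤s ())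
  bounded₀ : Bounded 0
  bounded₀ {zero}  {zero}  _ _ = s≤s z≤n
  bounded₀ {suc _} (s≤s ()) _
  bounded₀ {zero}  {suc _} _ (s≤s ())

nim-square : ∀ j → NimSquare j
nim-square zero    = square₀
nim-square (suc j) = next-square j (nim-square j)

Regime : ℕ → Pos → Set
Regime k (a , b , c) = 2 ^ (k ∸ 1) ≤ a × b < 2 ^ k

Claim : Pos → Set
Claim x = ∀ k → Regime k x → 𝒢 x ≡ total x

data Leading (k : ℕ) : ℕ → Set where
  none  : Leading k 0
  digit : ∀ j {β} → j < k → β < 2 ^ j → Leading k (2 ^ j + β)

leading : ∀ k {b} → b < 2 ^ k → Leading k b
leading zero    {zero}  _        = none
leading zero    {suc _} (s≤s ())
leading (suc k) b< with halves k b<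
... | upper β< = digit k ≤-refl β<
... | lower b<2^k with leading k b<2^k
...   | none           = none
...   | digit j j<k β< = digit j (m<n⇒m<1+n j<k) β<

leading-power : ∀ {j k} → j < k → 2 ^ j ≤ 2 ^ (k ∸ 1)
leading-power {k = suc k} (s≤s j≤k) = ^-monoʳ-≤ 2 j≤k

-- Every value v below the total is reached from (a, b, c):
--   c ≤ v       v = c + s, by (s, 0, c) when s < a, else by (a, s - a, c);
--   b ≤ v < c   v = b + r, by (r, b, 0) when r < a, else by (a, b, r - a);
--   v < b, c    inside the Nim plane, or from (a, β, γ) by top-bit cancellation;
-- the positions (a, _, c), (a, b, _) and (a, β, γ) are covered by induction.
module MainCase (a β j : ℕ) (a≥ : 2 ^ j ≤ a) (β< : β < 2 ^ j) where
  h : ℕ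
  h = 2 ^ j
  b : ℕ
  b = h + β
  open NimSquare (nim-square j)

  b< : b < 2 ^ suc j
  b< = upper-bound j β<

  Hypothesis : ℕ → Set
  Hypothesis c = ∀ y → total y < total (a , b , c) → Claim y

  reach-above-c : ∀ c → Hypothesis c → ∀ s → c + s < total (a , b , c) → Reaches (a , b , c) (c + s)
  reach-above-c c ih s v< with split a s
  ... | under s<a = (s , 0 , c) , keep₂-move (<⇒≤ s<a) z≤n (+-mono-<-≤ s<a z≤n) ,
                    trans (𝒢-empty₁ s c) (+-comm s c)
  ... | over r = y , mv , trans (ih y (move-decreases (a , b , c) y mv) (suc j) (a≥ , <-trans r<b b<))
                                (+-comm (a + r) c)
    where
    y : Pos
    y = (a , r , c)
    r<b : r < b
    r<b = +-cancelˡ-< a r b (+-cancelʳ-< c (a + r) (a + b) (subst (_< a + b + c) (+-comm c (a + r)) v<))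
    mv : Move (a , b , c) y
    mv = keep₂-move ≤-refl (<⇒≤ r<b) (+-monoʳ-< a r<b)

  reach-above-b : ∀ c → Hypothesis c → ∀ r → b + r < c → Reaches (a , b , c) (b + r)
  reach-above-b c ih r v<c with split a r
  ... | under r<a = (r , b , 0) , keep₁-move (<⇒≤ r<a) z≤n (+-mono-<-≤ r<a z≤n) ,
                    trans (𝒢-empty₂ r b) (+-comm r b)
  ... | over q = y , mv , trans (ih y (move-decreases (a , b , c) y mv) (suc j) (a≥ , b<)) (regroup a b q)
    where
    y : Pos
    y = (a , b , q)
    q<c : q < c
    q<c = ≤-<-trans (≤-trans (m≤n+m q a) (m≤n+m (a + q) b)) v<c
    mv : Move (a , b , c) y
    mv = keep₁-move ≤-refl (<⇒≤ q<c) (+-monoʳ-< a q<c)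
    regroup : ∀ a b q → a + b + q ≡ b + (a + q)
    regroup = solve-∀

  -- Values below heap 1 when 2^j ≤ c < 2^(j+1): a value 2^j + μ comes from
  -- the Nim plane by `top-bit-shift`; a value v < 2^j is reached from
  -- (a, β, γ), whose value a + β + γ ≥ 2^j is known by induction, and the
  -- move is then shifted up by `top-bit-agree`.
  reach-middle : ∀ γ → γ < h → Hypothesis (h + γ) → ∀ {v} → v < b → Reaches (a , b , h + γ) v
  reach-middle γ γ<h ih {v} v<b with split h v
  ... | over μ =
    let μ<β = +-cancelˡ-< h μ β v<b
        c' , c'<h , 𝒢≡μ = solvable-row j solvable β< (<-trans μ<β β<)
    in (0 , b , c') , to-plane₂ (<-≤-trans c'<h (m≤m+n h γ)) ,
       trans (top-bit-shift j solvable bounded β< c'<h) (cong (h +_) 𝒢≡μ)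
  ... | under v<h = shift-reaches h x₀ v<h agree (reaches-below x₀ v<𝒢x₀)
    where
    x₀ : Pos
    x₀ = (a , β , γ)
    agree : ∀ {y} → Move x₀ y → AgreeBelow h (𝒢 y) (𝒢 (translate h h y))
    agree {y} mv = top-bit-agree j solvable y (move-low x₀ y mv (β< , γ<h))
    x₀<x : total x₀ < total (a , b , h + γ)
    x₀<x = subst (total x₀ <_) (sym (total-translate h h x₀))
             (m<m+n (total x₀) (<-≤-trans (m^n>0 2 j) (m≤m+n h h)))
    𝒢x₀ : 𝒢 x₀ ≡ a + β + γ
    𝒢x₀ = ih x₀ x₀<x j (≤-trans (^-monoʳ-≤ 2 (m∸n≤m j 1)) a≥ , β<)
    v<𝒢x₀ : v < 𝒢 x₀
    v<𝒢x₀ = subst (v <_) (sym 𝒢x₀)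
              (<-≤-trans v<h (≤-trans a≥ (≤-trans (m≤m+n a β) (m≤m+n (a + β) γ))))

  -- Values below both Nim heaps: for c < 2^j or c ≥ 2^(j+1) they are reached
  -- inside the Nim plane, using the Nim square of level j resp. j + 1.
  reach-small : ∀ c → Hypothesis c → ∀ {v} → v < b → v < c → Reaches (a , b , c) v
  reach-small c ih {v} v<b v<c with split h c
  ... | under c<h =
    let b' , b'<h , 𝒢≡v = solvable c<h (<-trans v<c c<h)
    in (0 , b' , c) , to-plane₁ (<-≤-trans b'<h (m≤m+n h β)) , 𝒢≡v
  ... | over γ with split h γ
  ...   | under γ<h = reach-middle γ γ<h ih v<b
  ...   | over γ' =
    let solvable⁺ = NimSquare.solvable (nim-square (suc j))
        c' , c'< , 𝒢≡v = solvable-row (suc j) solvable⁺ b< (<-trans v<b b<)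
    in (0 , b , c') , to-plane₂ (<-≤-trans c'< (+-monoʳ-≤ h (+-monoʳ-≤ h z≤n))) , 𝒢≡v

  value : ∀ c → Hypothesis c → 𝒢 (a , b , c) ≡ total (a , b , c)
  value c ih = 𝒢-≡-total (a , b , c) reach
    where
    reach : ∀ {v} → v < total (a , b , c) → Reaches (a , b , c) v
    reach {v} v<t with split c v
    ... | over s = reach-above-c c ih s v<t
    ... | under v<c with split b v
    ...   | over r    = reach-above-b c ih r v<c
    ...   | under v<b = reach-small c ih v<b v<c

claim-step : ∀ x → (∀ y → total y < total x → Claim y) → Claim x
claim-step (a , b , c) ih k (a≥ , b<) with leading k b<
... | none             = trans (𝒢-empty₁ a c) (cong (_+ c) (sym (+-identityʳ a)))
... | digit j j<k β<   = MainCase.value a _ j (≤-trans (leading-power j<k) a≥) β< c ih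

proposition4p9 : (k x₀ x₁ x₂ : ℕ) → 2 ^ (k ∸ 1) ≤ x₀ → x₁ < 2 ^ k →
    𝒢 (x₀ , x₁ , x₂) ≡ x₀ + x₁ + x₂
proposition4p9 k x₀ x₁ x₂ x₀≥ x₁< =
  total-induction Claim claim-step (x₀ , x₁ , x₂) k (x₀≥ , x₁<)
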